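{- Let $n$ be odd and let $x$ and $y$ be distinct nonzero elements of $\mathbb{Z}_n$. If $\mathbb{Z}_n$ has a rotational sequencing $(b_1,\ldots,b_{n-1})$ in which $x$ and $y$ are cyclically adjacent (i.e. $\{x,y\} = \{b_i, b_{i+1}\}$ for some $i$, indices taken modulo $n-1$), then the elements of $\mathbb{Z}_n \setminus \{0,x,y\}$ can be ordered as $(a_1,\ldots,a_{n-3})$ so that the partial sums $a_1+\cdots+a_j$ ($1 \leq j \leq n-3$) are pairwise distinct and nonzero.
   Context: Let $\mathbf{a} = (a_1,\ldots,a_{n-1})$ be a cyclic arrangement of the nonzero elements of $\mathbb{Z}_n$ and define $\mathbf{b} = (b_1,\ldots,b_{n-1})$ by $b_i = a_{i+1} - a_i$ with indices modulo $n-1$ (so $b_{n-1} = a_1 - a_{n-1}$). If the elements of $\mathbf{b}$ are pairwise distinct, $\mathbf{a}$ is a directed rotational terrace and $\mathbf{b}$ is a rotational sequencing of $\mathbb{Z}_n$. -}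

module Defs where

open import Data.Nat using (ℕ; zero; suc; _+_; _∸_; _%_; NonZero)
open import Data.Nat.DivMod using (m%n<n)
open import Data.Fin using (Fin; toℕ; fromℕ<)
open import Data.Product using (Σ; ∃; _×_; _,_)
open import Data.Sum using (_⊎_)
open import Relation.Binary.PropositionalEquality using (_≡_; _≢_)
open import Function.Definitions using (Injective)

ℤ/ : ℕ → Set
ℤ/ n = Fin n

[_]mod : ∀ {n} .{{_ : NonZero n}} → ℕ → ℤ/ n
[_]mod {n} k = fromℕ< (m%n<n k n)

0ℤ : ∀ {n} .{{_ : NonZero n}} → ℤ/ n
0ℤ = [ 0 ]mod

_⊕_ : ∀ {n} .{{_ : NonZero n}} → ℤ/ n → ℤ/ n → ℤ/ n
_⊕_ {n} a b = [ toℕ a + toℕ b ]mod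

_⊖_ : ∀ {n} .{{_ : NonZero n}} → ℤ/ n → ℤ/ n → ℤ/ n
_⊖_ {n} a b = [ toℕ a + (n ∸ toℕ b) ]mod

csuc : ∀ {k} .{{_ : NonZero k}} → Fin k → Fin k
csuc {k} i = [ suc (toℕ i) ]mod

-- partial sums: psum a j = a_0 + ... + a_j  (0-based, so a_1+...+a_{j+1} in the paper)
psum : ∀ {n m} .{{_ : NonZero n}} → (Fin m → ℤ/ n) → Fin m → ℤ/ n
psum {m = zero} a ()
psum {m = suc m} a Fin.zero = a Fin.zero
psum {m = suc m} a (Fin.suc j) = a Fin.zero ⊕ psum (λ i → a (Fin.suc i)) j

-- a : Fin (n-1) → Z_n is a cyclic arrangement of the nonzero elements of Z_n:
-- injective with all values nonzero (hence a bijection onto Z_n \ {0} by counting).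
IsArrangementOfNonzero : ∀ n .{{_ : NonZero n}} → (Fin (n ∸ 1) → ℤ/ n) → Set
IsArrangementOfNonzero n a = Injective _≡_ _≡_ a × (∀ i → a i ≢ 0ℤ)

IsRotationalSequencing : ∀ n .{{_ : NonZero n}} .{{_ : NonZero (n ∸ 1)}} →
  (Fin (n ∸ 1) → ℤ/ n) → Set
IsRotationalSequencing n b =
  Σ (Fin (n ∸ 1) → ℤ/ n) λ a →
    IsArrangementOfNonzero n a ×
    (∀ i → b i ≡ (a (csuc i) ⊖ a i)) ×
    Injective _≡_ _≡_ b

CyclicallyAdjacent : ∀ {n k} .{{_ : NonZero k}} → (Fin k → ℤ/ n) → ℤ/ n → ℤ/ n → Set
CyclicallyAdjacent b x y =
  ∃ λ i → (b i ≡ x × b (csuc i) ≡ y) ⊎ (b i ≡ y × b (csuc i) ≡ x)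

-- Deleting the adjacent terms b_i = a_{i+1} - a_i and b_{i+1} from the sequencing
-- leaves b_{i+2}, ..., b_{i+n-2}, whose j-th partial sum telescopes to
-- a_{i+3+j} - a_{i+2}.  These sums are distinct and nonzero because the terrace a is
-- injective, while the terms themselves are distinct, nonzero (again by injectivity
-- of a) and different from b_i and b_{i+1}, i.e. from x and y.
module Submission where

open import Defs
open import Data.Nat using (ℕ; zero; suc; _+_; _*_; _∸_; _%_; _≤_; _<_; z≤n; s≤s; NonZero)
open import Data.Nat.Properties
open import Data.Nat.DivMod using (%-distribˡ-+; [m+n]%n≡m%n; m<n⇒m%n≡m; m%n<n)
open import Data.Fin using (Fin; toℕ)
open import Data.Fin.Properties using (toℕ-injective; toℕ-fromℕ<; toℕ<n)
open import Data.Product using (Σ; _×_; _,_)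
open import Data.Sum using (_⊎_; inj₁; inj₂)
open import Data.Empty using (⊥-elim)
open import Relation.Binary.PropositionalEquality
open import Function.Definitions using (Injective)
open import Algebra.Properties.CommutativeSemigroup +-commutativeSemigroup
  using (interchange; x∙yz≈y∙xz)

module _ {n : ℕ} .{{_ : NonZero n}} where

  toℕ-[]mod : ∀ u → toℕ ([_]mod {n} u) ≡ u % n
  toℕ-[]mod u = toℕ-fromℕ< (m%n<n u n)

  []mod-toℕ : (i : Fin n) → [ toℕ i ]mod ≡ i
  []mod-toℕ i = toℕ-injective (trans (toℕ-[]mod _) (m<n⇒m%n≡m (toℕ<n i)))

  []mod-injective-< : ∀ {t t'} → t < n → t' < n → [_]mod {n} t ≡ [ t' ]mod → t ≡ t'
  []mod-injective-< {t} {t'} t<n t'<n eq = begin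
    t             ≡⟨ sym (m<n⇒m%n≡m t<n) ⟩
    t % n         ≡⟨ sym (toℕ-[]mod t) ⟩
    toℕ [ t ]mod  ≡⟨ cong toℕ eq ⟩
    toℕ [ t' ]mod ≡⟨ toℕ-[]mod t' ⟩
    t' % n        ≡⟨ m<n⇒m%n≡m t'<n ⟩
    t'            ∎
    where open ≡-Reasoning

  []mod-+-congʳ : ∀ {u u'} v → [_]mod {n} u ≡ [ u' ]mod → [_]mod {n} (u + v) ≡ [ u' + v ]mod
  []mod-+-congʳ {u} {u'} v eq = toℕ-injective (begin
    toℕ [ u + v ]mod       ≡⟨ toℕ-[]mod _ ⟩
    (u + v) % n            ≡⟨ %-distribˡ-+ u v n ⟩
    (u % n + v % n) % n    ≡⟨ cong (λ r → (r + v % n) % n) u≡u' ⟩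
    (u' % n + v % n) % n   ≡⟨ sym (%-distribˡ-+ u' v n) ⟩
    (u' + v) % n           ≡⟨ sym (toℕ-[]mod _) ⟩
    toℕ [ u' + v ]mod      ∎)
    where
      open ≡-Reasoning
      u≡u' : u % n ≡ u' % n
      u≡u' = trans (sym (toℕ-[]mod u)) (trans (cong toℕ eq) (toℕ-[]mod u'))

  []mod-+-congˡ : ∀ u {v v'} → [_]mod {n} v ≡ [ v' ]mod → [_]mod {n} (u + v) ≡ [ u + v' ]mod
  []mod-+-congˡ u {v} {v'} eq = begin
    [ u + v ]mod  ≡⟨ cong [_]mod (+-comm u v) ⟩
    [ v + u ]mod  ≡⟨ []mod-+-congʳ u eq ⟩
    [ v' + u ]mod ≡⟨ cong [_]mod (+-comm v' u) ⟩
    [ u + v' ]mod ∎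
    where open ≡-Reasoning

  []mod-+n : ∀ u → [_]mod {n} (u + n) ≡ [ u ]mod
  []mod-+n u = toℕ-injective (trans (toℕ-[]mod _) (trans ([m+n]%n≡m%n u n) (sym (toℕ-[]mod u))))

  []mod-cancelʳ-+ : ∀ a b c → [_]mod {n} (a + c) ≡ [ b + c ]mod → [_]mod {n} a ≡ [ b ]mod
  []mod-cancelʳ-+ a b c eq = begin
    [ a ]mod          ≡⟨ sym (add-inverse a) ⟩
    [ a + c + -c ]mod ≡⟨ []mod-+-congʳ -c eq ⟩
    [ b + c + -c ]mod ≡⟨ add-inverse b ⟩
    [ b ]mod          ∎
    where
      open ≡-Reasoning
      -c : ℕ
      -c = n ∸ toℕ ([_]mod {n} c)
      c+-c≅n : [_]mod {n} (c + -c) ≡ [ n ]mod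
      c+-c≅n = trans ([]mod-+-congʳ -c (sym ([]mod-toℕ [ c ]mod)))
                     (cong [_]mod (m+[n∸m]≡n (<⇒≤ (toℕ<n ([_]mod {n} c)))))
      add-inverse : ∀ x → [_]mod {n} (x + c + -c) ≡ [ x ]mod
      add-inverse x = begin
        [ x + c + -c ]mod   ≡⟨ cong [_]mod (+-assoc x c -c) ⟩
        [ x + (c + -c) ]mod ≡⟨ []mod-+-congˡ x c+-c≅n ⟩
        [ x + n ]mod        ≡⟨ []mod-+n x ⟩
        [ x ]mod            ∎

  []mod-+-injectiveˡ : ∀ {t t'} c → t < n → t' < n →
                       [_]mod {n} (t + c) ≡ [ t' + c ]mod → t ≡ t'
  []mod-+-injectiveˡ {t} {t'} c t<n t'<n eq =
    []mod-injective-< t<n t'<n ([]mod-cancelʳ-+ t t' c eq)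

  csuc-[]mod : ∀ u → csuc ([_]mod {n} u) ≡ [ suc u ]mod
  csuc-[]mod u = []mod-+-congˡ 1 ([]mod-toℕ [ u ]mod)

  ⊖-cancelʳ : ∀ {u w} v → u ⊖ v ≡ w ⊖ v → u ≡ w
  ⊖-cancelʳ {u} {w} v eq = begin
    u              ≡⟨ sym ([]mod-toℕ u) ⟩
    [ toℕ u ]mod   ≡⟨ []mod-cancelʳ-+ (toℕ u) (toℕ w) (n ∸ toℕ v) eq ⟩
    [ toℕ w ]mod   ≡⟨ []mod-toℕ w ⟩
    w              ∎
    where open ≡-Reasoning

  x⊖x≡0ℤ : (v : Fin n) → v ⊖ v ≡ 0ℤ
  x⊖x≡0ℤ v = trans (cong [_]mod (m+[n∸m]≡n (<⇒≤ (toℕ<n v)))) ([]mod-+n 0)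

  x⊖y≡0ℤ⇒x≡y : ∀ {u v : Fin n} → u ⊖ v ≡ 0ℤ → u ≡ v
  x⊖y≡0ℤ⇒x≡y {u} {v} eq = ⊖-cancelʳ v (trans eq (sym (x⊖x≡0ℤ v)))

  [y⊖x]⊕[z⊖y]≡z⊖x : (x y z : Fin n) → (y ⊖ x) ⊕ (z ⊖ y) ≡ z ⊖ x
  [y⊖x]⊕[z⊖y]≡z⊖x x y z = begin
    [ toℕ [ Y + -X ]mod + toℕ [ Z + -Y ]mod ]mod ≡⟨ []mod-+-congʳ _ ([]mod-toℕ _) ⟩
    [ (Y + -X) + toℕ [ Z + -Y ]mod ]mod         ≡⟨ []mod-+-congˡ _ ([]mod-toℕ _) ⟩
    [ (Y + -X) + (Z + -Y) ]mod                  ≡⟨ cong [_]mod regroup ⟩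
    [ (Z + -X) + (Y + -Y) ]mod                  ≡⟨ cong (λ r → [ (Z + -X) + r ]mod) (m+[n∸m]≡n (<⇒≤ (toℕ<n y))) ⟩
    [ (Z + -X) + n ]mod                         ≡⟨ []mod-+n _ ⟩
    [ Z + -X ]mod                               ∎
    where
      open ≡-Reasoning
      X = toℕ x
      Y = toℕ y
      Z = toℕ z
      -X = n ∸ X
      -Y = n ∸ Y
      regroup : (Y + -X) + (Z + -Y) ≡ (Z + -X) + (Y + -Y)
      regroup = begin
        (Y + -X) + (Z + -Y) ≡⟨ cong (_+ (Z + -Y)) (+-comm Y -X) ⟩
        (-X + Y) + (Z + -Y) ≡⟨ interchange -X Y Z -Y ⟩
        (-X + Z) + (Y + -Y) ≡⟨ cong (_+ (Y + -Y)) (+-comm -X Z) ⟩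
        (Z + -X) + (Y + -Y) ∎

psum-telescope : ∀ {n p} .{{_ : NonZero n}} (f : Fin p → Fin n) (A : ℕ → Fin n) →
                 (∀ j → f j ≡ A (suc (toℕ j)) ⊖ A (toℕ j)) →
                 ∀ j → psum f j ≡ A (suc (toℕ j)) ⊖ A 0
psum-telescope f A f≡ΔA Fin.zero = f≡ΔA Fin.zero
psum-telescope f A f≡ΔA (Fin.suc j) = begin
  f Fin.zero ⊕ psum (λ i → f (Fin.suc i)) j
    ≡⟨ cong₂ _⊕_ (f≡ΔA Fin.zero) (psum-telescope _ (λ t → A (suc t)) (λ i → f≡ΔA (Fin.suc i)) j) ⟩
  (A 1 ⊖ A 0) ⊕ (A (suc (suc (toℕ j))) ⊖ A 1)
    ≡⟨ [y⊖x]⊕[z⊖y]≡z⊖x (A 0) (A 1) _ ⟩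
  A (suc (suc (toℕ j))) ⊖ A 0 ∎
  where open ≡-Reasoning

module DifferenceSequence {n k : ℕ} .{{_ : NonZero n}} .{{_ : NonZero k}} (2≤k : 2 ≤ k)
  {a b : Fin k → Fin n} (a-injective : Injective _≡_ _≡_ a)
  (b≡Δa : ∀ i → b i ≡ a (csuc i) ⊖ a i) (b-injective : Injective _≡_ _≡_ b) where

  0<k : 0 < k
  0<k = <-trans (s≤s z≤n) 2≤k

  b-nonzero : ∀ l → b l ≢ 0ℤ
  b-nonzero l bl≡0 = 1+n≢0 ([]mod-+-injectiveˡ (toℕ l) 2≤k 0<k csuc-l≡l)
    where
      csuc-l≡l : [_]mod {k} (1 + toℕ l) ≡ [ 0 + toℕ l ]mod
      csuc-l≡l = trans (a-injective (x⊖y≡0ℤ⇒x≡y (trans (sym (b≡Δa l)) bl≡0))) (sym ([]mod-toℕ l))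

  module Remainder (i : Fin k) where

    start : ℕ
    start = 2 + toℕ i

    rest : Fin (k ∸ 2) → Fin n
    rest j = b [ toℕ j + start ]mod

    rest-nonzero : ∀ j → rest j ≢ 0ℤ
    rest-nonzero j = b-nonzero _

    2+j<k : (j : Fin (k ∸ 2)) → 2 + toℕ j < k
    2+j<k j = subst (2 + toℕ j <_) (m+[n∸m]≡n 2≤k) (+-monoʳ-< 2 (toℕ<n j))

    1+j<k : (j : Fin (k ∸ 2)) → 1 + toℕ j < k
    1+j<k j = <-trans (n<1+n _) (2+j<k j)

    j<k : (j : Fin (k ∸ 2)) → toℕ j < k
    j<k j = <-trans (n<1+n _) (1+j<k j)

    rest-injective : Injective _≡_ _≡_ rest
    rest-injective {j} {j'} eq = toℕ-injective
      ([]mod-+-injectiveˡ start (j<k j) (j<k j') (b-injective eq))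

    rest-avoids-removed : ∀ j t → t < 2 → rest j ≢ b [ t + toℕ i ]mod
    rest-avoids-removed j t t<2 eq = <⇒≢ (≤-trans t<2 (m≤m+n 2 (toℕ j)))
      (sym ([]mod-+-injectiveˡ (toℕ i) (2+j<k j) (<-≤-trans t<2 2≤k)
        (trans (cong [_]mod (sym (x∙yz≈y∙xz (toℕ j) 2 (toℕ i)))) (b-injective eq))))

    avoids-b-i : ∀ j → rest j ≢ b i
    avoids-b-i j eq = rest-avoids-removed j 0 (s≤s z≤n) (trans eq (cong b (sym ([]mod-toℕ i))))

    avoids-b-csuc-i : ∀ j → rest j ≢ b (csuc i)
    avoids-b-csuc-i j = rest-avoids-removed j 1 (s≤s (s≤s z≤n))

    rest-avoids-adjacent : ∀ {x y} → (b i ≡ x × b (csuc i) ≡ y) ⊎ (b i ≡ y × b (csuc i) ≡ x) →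
                           ∀ j → rest j ≢ x × rest j ≢ y
    rest-avoids-adjacent (inj₁ (bi≡x , bi'≡y)) j =
      subst (rest j ≢_) bi≡x (avoids-b-i j) , subst (rest j ≢_) bi'≡y (avoids-b-csuc-i j)
    rest-avoids-adjacent (inj₂ (bi≡y , bi'≡x)) j =
      subst (rest j ≢_) bi'≡x (avoids-b-csuc-i j) , subst (rest j ≢_) bi≡y (avoids-b-i j)

    α : ℕ → Fin n
    α t = a [ t + start ]mod

    rest≡Δα : ∀ j → rest j ≡ α (suc (toℕ j)) ⊖ α (toℕ j)
    rest≡Δα j = trans (b≡Δa _) (cong (λ l → a l ⊖ α (toℕ j)) (csuc-[]mod (toℕ j + start)))

    psum-rest : ∀ j → psum rest j ≡ α (suc (toℕ j)) ⊖ α 0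
    psum-rest = psum-telescope rest α rest≡Δα

    α-injective : ∀ {t t'} → t < k → t' < k → α t ≡ α t' → t ≡ t'
    α-injective t<k t'<k eq = []mod-+-injectiveˡ start t<k t'<k (a-injective eq)

    psum-rest-injective : Injective _≡_ _≡_ (psum rest)
    psum-rest-injective {j} {j'} eq = toℕ-injective (suc-injective (α-injective (1+j<k j) (1+j<k j')
      (⊖-cancelʳ (α 0) (trans (sym (psum-rest j)) (trans eq (psum-rest j'))))))

    psum-rest-nonzero : ∀ j → psum rest j ≢ 0ℤ
    psum-rest-nonzero j eq = 1+n≢0 (α-injective (1+j<k j) 0<k
      (x⊖y≡0ℤ⇒x≡y (trans (sym (psum-rest j)) eq)))

lemma4p4 : (m : ℕ) → let n = suc (2 * m) in
    (x y : ℤ/ n) → x ≢ 0ℤ → y ≢ 0ℤ → x ≢ y →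
    .{{_ : NonZero (n ∸ 1)}} →
    (b : Fin (n ∸ 1) → ℤ/ n) → IsRotationalSequencing n b → CyclicallyAdjacent b x y →
    Σ (Fin (n ∸ 3) → ℤ/ n) λ a →
    Injective _≡_ _≡_ a ×
    (∀ i → a i ≢ 0ℤ × a i ≢ x × a i ≢ y) ×
    Injective _≡_ _≡_ (psum a) ×
    (∀ j → psum a j ≢ 0ℤ)
lemma4p4 zero Fin.zero y x≢0 _ _ = ⊥-elim (x≢0 refl)
lemma4p4 (suc m) x y _ _ _ b (a , (a-injective , _) , b≡Δa , b-injective) (i , adjacent) =
  rest , rest-injective , (λ j → rest-nonzero j , rest-avoids-adjacent adjacent j) ,
  psum-rest-injective , psum-rest-nonzero
  where
    open DifferenceSequence (*-monoʳ-≤ 2 (s≤s (z≤n {m}))) a-injective b≡Δa b-injective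
    open Remainder i
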